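{- Let $n$ be a positive even integer. Then in the polynomial ring $\mathbb{Q}[x,y]$, \[\sum_{0\le k\le n,\ k\text{ even}}\binom{n}{k}2^k(-1)^{k/2}(x^2+y^2)^{n-k}(xy)^k\left(\tfrac12\right)_{k/2}\Gamma(n-k/2)=\Gamma(n)\,(x^{2n}+y^{2n}).\]
   Context: $(z)_j=z(z+1)\cdots(z+j-1)$ is the Pochhammer symbol, and $\Gamma$ is the Gamma function (so $\Gamma(m)=(m-1)!$ for positive integers $m$). -}

module Defs where

open import Data.Nat as ℕ using (ℕ; zero; suc; _∸_; _≤_; _%_; _/_; _!)
open import Data.Nat.Combinatorics using (_C_)
open import Data.Integer using (+_)
open import Data.Rational as ℚ using (ℚ; 0ℚ; 1ℚ; ½; _+_; _*_; -_)
open import Relation.Nullary using (yes; no)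
open import Relation.Binary.PropositionalEquality using (_≡_)

ℕ→ℚ : ℕ → ℚ
ℕ→ℚ m = + m ℚ./ 1

_^ℚ_ : ℚ → ℕ → ℚ
q ^ℚ zero  = 1ℚ
q ^ℚ suc m = (q ^ℚ m) * q

poch : ℚ → ℕ → ℚ
poch z zero    = 1ℚ
poch z (suc j) = poch z j * (z + ℕ→ℚ j)

-- Gamma function at a positive integer m : Γ(m) = (m-1)!
-- (only ever applied to positive integers)
ΓNat : ℕ → ℚ
ΓNat m = ℕ→ℚ ((m ∸ 1) !)

Even : ℕ → Set
Even m = m % 2 ≡ 0

-- Polynomials in Q[x,y], represented by their coefficient functions:
-- p i j is the coefficient of x^i y^j.

Poly : Set
Poly = ℕ → ℕ → ℚ

sumTo : ℕ → (ℕ → ℚ) → ℚ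
sumTo zero    f = f 0
sumTo (suc m) f = sumTo m f + f (suc m)

δ : ℕ → ℕ → ℚ
δ zero    zero    = 1ℚ
δ zero    (suc _) = 0ℚ
δ (suc _) zero    = 0ℚ
δ (suc a) (suc b) = δ a b

constP : ℚ → Poly
constP c i j = c * (δ i 0 * δ j 0)

X : Poly
X i j = δ i 1 * δ j 0

Y : Poly
Y i j = δ i 0 * δ j 1

_+P_ : Poly → Poly → Poly
(p +P q) i j = p i j + q i j

_*P_ : Poly → Poly → Poly
(p *P q) i j = sumTo i (λ a → sumTo j (λ b → p a b * q (i ∸ a) (j ∸ b)))

_·P_ : ℚ → Poly → Poly
(c ·P p) i j = c * p i j

_^P_ : Poly → ℕ → Poly
p ^P zero  = constP 1ℚ
p ^P suc m = (p ^P m) *P p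

0P : Poly
0P = constP 0ℚ

sumP : ℕ → (ℕ → Poly) → Poly
sumP zero    F = F 0
sumP (suc m) F = sumP m F +P F (suc m)

_≈P_ : Poly → Poly → Set
p ≈P q = ∀ i j → p i j ≡ q i j

term : ℕ → ℕ → Poly
term n k with k % 2 ℕ.≟ 0
... | yes _ = ((ℕ→ℚ (n C k) * ((ℕ→ℚ 2 ^ℚ k) * ((- 1ℚ) ^ℚ (k / 2))))
               * (poch ½ (k / 2) * ΓNat (n ∸ (k / 2))))
              ·P ((((X ^P 2) +P (Y ^P 2)) ^P (n ∸ k)) *P ((X *P Y) ^P k))
... | no  _ = 0P

LHS : ℕ → Poly
LHS n = sumP n (term n)

RHS : ℕ → Poly
RHS n = ΓNat n ·P ((X ^P (2 ℕ.* n)) +P (Y ^P (2 ℕ.* n)))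

module Submission where

open import Defs
open import Data.Nat using (ℕ; _≤_)
open import Algebra.Bundles using (CommutativeRing)

-- Put k = 2j, s = x² + y² and p = x²y².  Since (½)_j 2^j = (2j − 1)!! and
-- (2j)! = (2j − 1)!! 2^j j!, the coefficient of s^(n−2j) p^j on the left is
-- Γ(n) (−1)^j L(n, j) with L(n, j) = n/(n − j) · C(n − j, j).  These are the
-- coefficients of Waring's formula
--   u^n + v^n = Σ_j (−1)^j L(n, j) (u + v)^(n−2j) (uv)^j,
-- valid in every commutative ring because both sides satisfy
-- a(n+2) = (u + v) a(n+1) − uv a(n).  Taking u = x², v = y² gives the right-hand side.

module Naturals where

  open import Data.Nat
  open import Data.Nat.Properties
  open import Data.Nat.Combinatorics using (_C_; nCk≡n!/k![n-k]!; k![n∸k]!∣n!)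
  open import Data.Nat.DivMod using (m/n*n≡m; m*n/n≡m; m*n%n≡0; [m+kn]%n≡m%n; m≡m%n+[m/n]*n)
  open import Data.Nat.Tactic.RingSolver using (solve-∀; solve)
  open import Data.List.Base using (_∷_; [])
  open import Relation.Binary.PropositionalEquality
  open ≡-Reasoning

  double : ℕ → ℕ
  double zero    = zero
  double (suc j) = suc (suc (double j))

  double≡+ : ∀ j → double j ≡ j + j
  double≡+ zero    = refl
  double≡+ (suc j) = cong suc (trans (cong suc (double≡+ j)) (sym (+-suc j j)))

  double≡* : ∀ j → double j ≡ j * 2
  double≡* j = trans (double≡+ j) (solve (j ∷ []))

  double-mono-≤ : ∀ {m n} → m ≤ n → double m ≤ double n
  double-mono-≤ z≤n       = z≤n
  double-mono-≤ (s≤s m≤n) = s≤s (s≤s (double-mono-≤ m≤n))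

  double-mono-< : ∀ {m n} → m < n → double m < double n
  double-mono-< m<n = ≤-trans (n≤1+n _) (double-mono-≤ m<n)

  n<double[1+n] : ∀ n → n < double (suc n)
  n<double[1+n] n = s≤s (m≤n⇒m≤1+n (subst (n ≤_) (sym (double≡+ n)) (m≤m+n n n)))

  double+∸ : ∀ j r → double j + r ∸ j ≡ j + r
  double+∸ j r = begin
    double j + r ∸ j ≡⟨ cong (λ d → d + r ∸ j) (double≡+ j) ⟩
    j + j + r ∸ j    ≡⟨ cong (_∸ j) (+-assoc j j r) ⟩
    j + (j + r) ∸ j  ≡⟨ m+n∸m≡n j (j + r) ⟩
    j + r            ∎

  double/2≡ : ∀ j → double j / 2 ≡ j
  double/2≡ j = trans (cong (_/ 2) (double≡* j)) (m*n/n≡m j 2)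

  double%2≡0 : ∀ j → double j % 2 ≡ 0
  double%2≡0 j = trans (cong (_% 2) (double≡* j)) (m*n%n≡0 j 2)

  [1+double]%2≡1 : ∀ j → suc (double j) % 2 ≡ 1
  [1+double]%2≡1 j = trans (cong (λ m → suc m % 2) (double≡* j)) ([m+kn]%n≡m%n 1 j 2)

  even⇒double : ∀ n → Even n → n ≡ double (n / 2)
  even⇒double n n-even = begin
    n                  ≡⟨ m≡m%n+[m/n]*n n 2 ⟩
    n % 2 + n / 2 * 2  ≡⟨ cong (_+ n / 2 * 2) n-even ⟩
    n / 2 * 2          ≡⟨ double≡* (n / 2) ⟨
    double (n / 2)     ∎

  nCk*[k!*[n∸k]!]≡n! : ∀ {n k} → k ≤ n → (n C k) * (k ! * (n ∸ k) !) ≡ n !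
  nCk*[k!*[n∸k]!]≡n! {n} {k} k≤n = begin
    (n C k) * (k ! * (n ∸ k) !)             ≡⟨ cong (_* (k ! * (n ∸ k) !)) (nCk≡n!/k![n-k]! k≤n) ⟩
    n ! / (k ! * (n ∸ k) !) * (k ! * (n ∸ k) !) ≡⟨ m/n*n≡m (k![n∸k]!∣n! k≤n) ⟩
    n !                                     ∎
    where instance _ = k !* (n ∸ k) !≢0

  [k+r]Ck*[k!*r!]≡[k+r]! : ∀ k r → ((k + r) C k) * (k ! * r !) ≡ (k + r) !
  [k+r]Ck*[k!*r!]≡[k+r]! k r =
    subst (λ m → ((k + r) C k) * (k ! * m !) ≡ (k + r) !) (m+n∸m≡n k r) (nCk*[k!*[n∸k]!]≡n! (m≤m+n k r))

  oddDoubleFactorial : ℕ → ℕ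
  oddDoubleFactorial zero    = 1
  oddDoubleFactorial (suc j) = oddDoubleFactorial j * suc (double j)

  oddDoubleFactorial*2^j*j!≡[2j]! : ∀ j → oddDoubleFactorial j * (2 ^ j * j !) ≡ double j !
  oddDoubleFactorial*2^j*j!≡[2j]! zero    = refl
  oddDoubleFactorial*2^j*j!≡[2j]! (suc j) = begin
    o * suc (double j) * (2 * 2 ^ j * (suc j * j !))
      ≡⟨ regroup o (double j) j (2 ^ j) (j !) (double≡+ j) ⟩
    suc (suc (double j)) * (suc (double j) * (o * (2 ^ j * j !)))
      ≡⟨ cong (λ m → suc (suc (double j)) * (suc (double j) * m)) (oddDoubleFactorial*2^j*j!≡[2j]! j) ⟩
    suc (suc (double j)) * (suc (double j) * double j !) ∎
    where
    o = oddDoubleFactorial j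
    regroup : ∀ o d j P F → d ≡ j + j →
      o * suc d * (2 * P * (suc j * F)) ≡ suc (suc d) * (suc d * (o * (P * F)))
    regroup o d j P F refl = solve (o ∷ j ∷ P ∷ F ∷ [])

  -- The recursion mirrors u^(n+2) + v^(n+2) = (u + v)(u^(n+1) + v^(n+1)) − uv(u^n + v^n).
  lucasCoeff : ℕ → ℕ → ℕ
  lucasCoeff zero          zero    = 2
  lucasCoeff zero          (suc j) = 0
  lucasCoeff (suc zero)    zero    = 1
  lucasCoeff (suc zero)    (suc j) = 0
  lucasCoeff (suc (suc n)) zero    = 1
  lucasCoeff (suc (suc n)) (suc j) = lucasCoeff (suc n) (suc j) + lucasCoeff n j

  lucasCoeff-head : ∀ n → lucasCoeff (suc n) 0 ≡ 1
  lucasCoeff-head zero    = refl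
  lucasCoeff-head (suc n) = refl

  lucasCoeff-vanishes : ∀ {n j} → n < double j → lucasCoeff n j ≡ 0
  lucasCoeff-vanishes {zero}        {suc j} _         = refl
  lucasCoeff-vanishes {suc zero}    {suc j} _         = refl
  lucasCoeff-vanishes {suc (suc n)} {suc j} (s≤s (s≤s n<2j))
    rewrite lucasCoeff-vanishes {suc n} {suc j} (m<n⇒m<1+n (s≤s n<2j))
          | lucasCoeff-vanishes {n} {j} n<2j = refl

  lucasCoeff-diagonal : ∀ j → lucasCoeff (double j) j ≡ 2
  lucasCoeff-diagonal zero = refl
  lucasCoeff-diagonal (suc j)
    rewrite lucasCoeff-vanishes {suc (double j)} {suc j} (n<1+n (suc (double j)))
          | lucasCoeff-diagonal j = refl

  -- L(n, j) · j! (n − 2j)! = n (n − j − 1)!, multiplied by n − j so that n = 0 needs no exception.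
  lucasCoeff-closedForm : ∀ j r → lucasCoeff (double j + r) j * (j ! * r ! * (j + r)) ≡ (double j + r) * (j + r) !
  lucasCoeff-closedForm zero    zero    = refl
  lucasCoeff-closedForm zero    (suc r) rewrite lucasCoeff-head r = base (suc r) ((suc r) !)
    where
    base : ∀ m F → 1 * (1 * F * m) ≡ m * F
    base = solve-∀
  lucasCoeff-closedForm (suc j) zero
    rewrite +-identityʳ (double j) | +-identityʳ j | lucasCoeff-diagonal (suc j)
    = diagonal (double j) j (j !) (double≡+ j)
    where
    diagonal : ∀ d j F → d ≡ j + j → 2 * (suc j * F * 1 * suc j) ≡ suc (suc d) * (suc j * F)
    diagonal d j F refl = solve (j ∷ F ∷ [])
  lucasCoeff-closedForm (suc j) (suc r)
    rewrite +-suc (double j) r | +-suc j r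
    = inductiveStep (double j) j r (j !) (r !)
        (lucasCoeff (double (suc j) + r) (suc j)) (lucasCoeff (suc (double j + r)) j) (double≡+ j)
        (lucasCoeff-closedForm (suc j) r)
        (subst₂ (λ n m → lucasCoeff n j * (j ! * (suc r) ! * m) ≡ n * m !)
                (+-suc (double j) r) (+-suc j r) (lucasCoeff-closedForm j (suc r)))
    where
    inductiveStep : ∀ d j r A B L₁ L₂ {F} → d ≡ j + j →
      L₁ * (suc j * A * B * suc (j + r)) ≡ suc (suc (d + r)) * F →
      L₂ * (A * (suc r * B) * suc (j + r)) ≡ suc (d + r) * F →
      (L₁ + L₂) * (suc j * A * (suc r * B) * suc (suc (j + r)))
        ≡ suc (suc (suc (d + r))) * (suc (suc (j + r)) * F)
    inductiveStep d j r A B L₁ L₂ {F} refl h₁ h₂ = *-cancelʳ-≡ _ _ (suc (j + r)) (begin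
      (L₁ + L₂) * (suc j * A * (suc r * B) * suc (suc (j + r))) * suc (j + r)
        ≡⟨ solve (j ∷ r ∷ A ∷ B ∷ L₁ ∷ L₂ ∷ []) ⟩
      suc (suc (j + r)) * (suc r * (L₁ * (suc j * A * B * suc (j + r)))
                           + suc j * (L₂ * (A * (suc r * B) * suc (j + r))))
        ≡⟨ cong₂ (λ x y → suc (suc (j + r)) * (suc r * x + suc j * y)) h₁ h₂ ⟩
      suc (suc (j + r)) * (suc r * (suc (suc (j + j + r)) * F) + suc j * (suc (j + j + r) * F))
        ≡⟨ solve (j ∷ r ∷ F ∷ []) ⟩
      suc (suc (suc (j + j + r))) * (suc (suc (j + r)) * F) * suc (j + r) ∎)

  lucasCoeff-factorial′ : ∀ j r {a b} → j + r ≡ suc a → double j + r ≡ suc b →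
    ((double j + r) C (double j)) * oddDoubleFactorial j * 2 ^ j * a ! ≡ b ! * lucasCoeff (double j + r) j
  lucasCoeff-factorial′ j r {a} {b} j+r≡1+a n≡1+b = *-cancelʳ-≡ _ _ D {{D≢0}} (begin
    K * o * 2 ^ j * a ! * D                 ≡⟨ regroupˡ K o (2 ^ j) a (a !) (j !) (r !) ⟩
    K * (o * (2 ^ j * j !) * r !) * suc a ! ≡⟨ cong (λ m → K * (m * r !) * suc a !) (oddDoubleFactorial*2^j*j!≡[2j]! j) ⟩
    K * (double j ! * r !) * suc a !        ≡⟨ cong (_* suc a !) ([k+r]Ck*[k!*r!]≡[k+r]! (double j) r) ⟩
    n ! * suc a !                           ≡⟨ cong (λ m → m ! * suc a !) n≡1+b ⟩
    suc b ! * suc a !                       ≡⟨ regroupʳ b (b !) (suc a !) ⟩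
    b ! * (suc b * suc a !)                 ≡⟨ cong₂ (λ m k → b ! * (m * k !)) n≡1+b j+r≡1+a ⟨
    b ! * (n * (j + r) !)                   ≡⟨ cong (b ! *_) (lucasCoeff-closedForm j r) ⟨
    b ! * (L * (j ! * r ! * (j + r)))       ≡⟨ cong (λ m → b ! * (L * (j ! * r ! * m))) j+r≡1+a ⟩
    b ! * (L * D)                           ≡⟨ *-assoc (b !) L D ⟨
    b ! * L * D                             ∎)
    where
    n = double j + r
    K = n C (double j)
    o = oddDoubleFactorial j
    L = lucasCoeff n j
    D = j ! * r ! * suc a
    D≢0 : NonZero D
    D≢0 = m*n≢0 (j ! * r !) (suc a) {{j !* r !≢0}}
    regroupˡ : ∀ K o P a A J R → K * o * P * A * (J * R * suc a) ≡ K * (o * (P * J) * R) * (suc a * A)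
    regroupˡ = solve-∀
    regroupʳ : ∀ b B F → suc b * B * F ≡ B * (suc b * F)
    regroupʳ = solve-∀

  lucasCoeff-factorial : ∀ j r → 1 ≤ double j + r →
    ((double j + r) C (double j)) * oddDoubleFactorial j * 2 ^ j * (j + r ∸ 1) !
      ≡ (double j + r ∸ 1) ! * lucasCoeff (double j + r) j
  lucasCoeff-factorial zero    (suc r) _ = lucasCoeff-factorial′ zero (suc r) refl refl
  lucasCoeff-factorial (suc j) r       _ = lucasCoeff-factorial′ (suc j) r refl refl

module Rationals where

  open Naturals
  open import Data.Nat as ℕ using (ℕ; zero; suc; _∸_; _!; _≤_)
  import Data.Nat.Properties as ℕ
  open import Data.Nat.Combinatorics using (_C_)
  open import Data.Integer as ℤ using (+_)
  import Data.Integer.Properties as ℤₚ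
  open import Data.Rational using (ℚ; 1ℚ; ½; _+_; _*_; -_; toℚᵘ)
  open import Data.Rational.Properties using (*-distribʳ-+; toℚᵘ-injective; toℚᵘ-fromℚᵘ; toℚᵘ-homo-+; toℚᵘ-homo-*)
  open import Data.Rational.Unnormalised as ℚᵘ using (mkℚᵘ; *≡*)
  import Data.Rational.Unnormalised.Properties as ℚᵘ
  open import Data.Rational.Solver using (module +-*-Solver)
  open +-*-Solver using (solve; _:*_; _:=_)
  open import Relation.Binary.PropositionalEquality

  toℚᵘ-ℕ→ℚ : ∀ a → toℚᵘ (ℕ→ℚ a) ℚᵘ.≃ mkℚᵘ (+ a) 0
  toℚᵘ-ℕ→ℚ a = toℚᵘ-fromℚᵘ (mkℚᵘ (+ a) 0)

  ℕ→ℚ-+ : ∀ a b → ℕ→ℚ (a ℕ.+ b) ≡ ℕ→ℚ a + ℕ→ℚ b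
  ℕ→ℚ-+ a b = toℚᵘ-injective (begin-equality
    toℚᵘ (ℕ→ℚ (a ℕ.+ b))                 ≃⟨ toℚᵘ-ℕ→ℚ (a ℕ.+ b) ⟩
    mkℚᵘ (+ (a ℕ.+ b)) 0                  ≃⟨ *≡* (cong (ℤ._* + 1) numerators) ⟩
    mkℚᵘ (+ a) 0 ℚᵘ.+ mkℚᵘ (+ b) 0        ≃⟨ ℚᵘ.+-cong (toℚᵘ-ℕ→ℚ a) (toℚᵘ-ℕ→ℚ b) ⟨
    toℚᵘ (ℕ→ℚ a) ℚᵘ.+ toℚᵘ (ℕ→ℚ b)       ≃⟨ toℚᵘ-homo-+ (ℕ→ℚ a) (ℕ→ℚ b) ⟨
    toℚᵘ (ℕ→ℚ a + ℕ→ℚ b)                 ∎)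
    where
    open ℚᵘ.≤-Reasoning
    numerators : + (a ℕ.+ b) ≡ + a ℤ.* + 1 ℤ.+ + b ℤ.* + 1
    numerators = trans (ℤₚ.pos-+ a b) (sym (cong₂ ℤ._+_ (ℤₚ.*-identityʳ (+ a)) (ℤₚ.*-identityʳ (+ b))))

  ℕ→ℚ-* : ∀ a b → ℕ→ℚ (a ℕ.* b) ≡ ℕ→ℚ a * ℕ→ℚ b
  ℕ→ℚ-* a b = toℚᵘ-injective (begin-equality
    toℚᵘ (ℕ→ℚ (a ℕ.* b))                 ≃⟨ toℚᵘ-ℕ→ℚ (a ℕ.* b) ⟩
    mkℚᵘ (+ (a ℕ.* b)) 0                  ≃⟨ *≡* (cong (ℤ._* + 1) (ℤₚ.pos-* a b)) ⟩
    mkℚᵘ (+ a) 0 ℚᵘ.* mkℚᵘ (+ b) 0        ≃⟨ ℚᵘ.*-cong (toℚᵘ-ℕ→ℚ a) (toℚᵘ-ℕ→ℚ b) ⟨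
    toℚᵘ (ℕ→ℚ a) ℚᵘ.* toℚᵘ (ℕ→ℚ b)       ≃⟨ toℚᵘ-homo-* (ℕ→ℚ a) (ℕ→ℚ b) ⟨
    toℚᵘ (ℕ→ℚ a * ℕ→ℚ b)                 ∎)
    where open ℚᵘ.≤-Reasoning

  ℕ→ℚ-^ : ∀ m j → ℕ→ℚ m ^ℚ j ≡ ℕ→ℚ (m ℕ.^ j)
  ℕ→ℚ-^ m zero    = refl
  ℕ→ℚ-^ m (suc j) = begin
    ℕ→ℚ m ^ℚ j * ℕ→ℚ m    ≡⟨ cong (_* ℕ→ℚ m) (ℕ→ℚ-^ m j) ⟩
    ℕ→ℚ (m ℕ.^ j) * ℕ→ℚ m ≡⟨ ℕ→ℚ-* (m ℕ.^ j) m ⟨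
    ℕ→ℚ (m ℕ.^ j ℕ.* m)   ≡⟨ cong ℕ→ℚ (ℕ.*-comm (m ℕ.^ j) m) ⟩
    ℕ→ℚ (m ℕ.^ suc j)     ∎
    where open ≡-Reasoning

  ^ℚ-double : ∀ q j → q ^ℚ double j ≡ q ^ℚ j * q ^ℚ j
  ^ℚ-double q zero    = refl
  ^ℚ-double q (suc j) = begin
    q ^ℚ double j * q * q             ≡⟨ cong (λ x → x * q * q) (^ℚ-double q j) ⟩
    q ^ℚ j * q ^ℚ j * q * q           ≡⟨ regroup (q ^ℚ j) q ⟩
    q ^ℚ j * q * (q ^ℚ j * q)         ∎
    where
    open ≡-Reasoning
    regroup : ∀ x q → x * x * q * q ≡ x * q * (x * q)
    regroup = solve 2 (λ x q → x :* x :* q :* q := x :* q :* (x :* q)) refl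

  [½+n]*2≡2n+1 : ∀ n → (½ + ℕ→ℚ n) * ℕ→ℚ 2 ≡ ℕ→ℚ (suc (double n))
  [½+n]*2≡2n+1 n = begin
    (½ + ℕ→ℚ n) * ℕ→ℚ 2           ≡⟨ *-distribʳ-+ (ℕ→ℚ 2) ½ (ℕ→ℚ n) ⟩
    ½ * ℕ→ℚ 2 + ℕ→ℚ n * ℕ→ℚ 2     ≡⟨ cong (λ q → ℕ→ℚ 1 + q) (ℕ→ℚ-* n 2) ⟨
    ℕ→ℚ 1 + ℕ→ℚ (n ℕ.* 2)         ≡⟨ ℕ→ℚ-+ 1 (n ℕ.* 2) ⟨
    ℕ→ℚ (suc (n ℕ.* 2))           ≡⟨ cong (λ m → ℕ→ℚ (suc m)) (double≡* n) ⟨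
    ℕ→ℚ (suc (double n))          ∎
    where open ≡-Reasoning

  poch-½*2^j≡oddDoubleFactorial : ∀ j → poch ½ j * ℕ→ℚ 2 ^ℚ j ≡ ℕ→ℚ (oddDoubleFactorial j)
  poch-½*2^j≡oddDoubleFactorial zero    = refl
  poch-½*2^j≡oddDoubleFactorial (suc j) = begin
    poch ½ j * (½ + ℕ→ℚ j) * (ℕ→ℚ 2 ^ℚ j * ℕ→ℚ 2)    ≡⟨ regroup (poch ½ j) (½ + ℕ→ℚ j) (ℕ→ℚ 2 ^ℚ j) (ℕ→ℚ 2) ⟩
    poch ½ j * ℕ→ℚ 2 ^ℚ j * ((½ + ℕ→ℚ j) * ℕ→ℚ 2)    ≡⟨ cong₂ _*_ (poch-½*2^j≡oddDoubleFactorial j) ([½+n]*2≡2n+1 j) ⟩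
    ℕ→ℚ (oddDoubleFactorial j) * ℕ→ℚ (suc (double j)) ≡⟨ ℕ→ℚ-* (oddDoubleFactorial j) (suc (double j)) ⟨
    ℕ→ℚ (oddDoubleFactorial (suc j))                  ∎
    where
    open ≡-Reasoning
    regroup : ∀ a b c d → a * b * (c * d) ≡ a * c * (b * d)
    regroup = solve 4 (λ a b c d → a :* b :* (c :* d) := a :* c :* (b :* d)) refl

  termCoeff : ℕ → ℕ → ℚ
  termCoeff n k = (ℕ→ℚ (n C k) * ((ℕ→ℚ 2 ^ℚ k) * ((- 1ℚ) ^ℚ (k ℕ./ 2)))) * (poch ½ (k ℕ./ 2) * ΓNat (n ∸ (k ℕ./ 2)))

  termCoeff-double : ∀ j r → 1 ≤ double j ℕ.+ r →
    termCoeff (double j ℕ.+ r) (double j) ≡ ΓNat (double j ℕ.+ r) * ((- 1ℚ) ^ℚ j * ℕ→ℚ (lucasCoeff (double j ℕ.+ r) j))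
  termCoeff-double j r 1≤n rewrite double/2≡ j | double+∸ j r = begin
    K * (two ^ℚ double j * sign) * (poch ½ j * Γ)       ≡⟨ cong (λ x → K * (x * sign) * (poch ½ j * Γ)) (^ℚ-double two j) ⟩
    K * (two ^ℚ j * two ^ℚ j * sign) * (poch ½ j * Γ)   ≡⟨ regroup K (two ^ℚ j) sign (poch ½ j) Γ ⟩
    sign * (K * (poch ½ j * two ^ℚ j) * two ^ℚ j * Γ)   ≡⟨ cong₂ (λ x y → sign * (K * x * y * Γ)) (poch-½*2^j≡oddDoubleFactorial j) (ℕ→ℚ-^ 2 j) ⟩
    sign * (K * ℕ→ℚ o * ℕ→ℚ (2 ℕ.^ j) * Γ)             ≡⟨ cong (sign *_) (ℕ→ℚ-*⁴ (n C double j) o (2 ℕ.^ j) ((j ℕ.+ r ∸ 1) !)) ⟨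
    sign * ℕ→ℚ ((n C double j) ℕ.* o ℕ.* 2 ℕ.^ j ℕ.* (j ℕ.+ r ∸ 1) !) ≡⟨ cong (λ m → sign * ℕ→ℚ m) (lucasCoeff-factorial j r 1≤n) ⟩
    sign * ℕ→ℚ ((n ∸ 1) ! ℕ.* L)                        ≡⟨ cong (sign *_) (ℕ→ℚ-* ((n ∸ 1) !) L) ⟩
    sign * (ΓNat n * ℕ→ℚ L)                             ≡⟨ swap sign (ΓNat n) (ℕ→ℚ L) ⟩
    ΓNat n * (sign * ℕ→ℚ L)                             ∎
    where
    open ≡-Reasoning
    n = double j ℕ.+ r
    K = ℕ→ℚ (n C double j)
    two = ℕ→ℚ 2
    sign = (- 1ℚ) ^ℚ j
    Γ = ℕ→ℚ ((j ℕ.+ r ∸ 1) !)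
    o = oddDoubleFactorial j
    L = lucasCoeff n j
    regroup : ∀ K t s p Γ → K * (t * t * s) * (p * Γ) ≡ s * (K * (p * t) * t * Γ)
    regroup = solve 5 (λ K t s p Γ → K :* (t :* t :* s) :* (p :* Γ) := s :* (K :* (p :* t) :* t :* Γ)) refl
    swap : ∀ s g l → s * (g * l) ≡ g * (s * l)
    swap = solve 3 (λ s g l → s :* (g :* l) := g :* (s :* l)) refl
    ℕ→ℚ-*⁴ : ∀ a b c d → ℕ→ℚ (a ℕ.* b ℕ.* c ℕ.* d) ≡ ℕ→ℚ a * ℕ→ℚ b * ℕ→ℚ c * ℕ→ℚ d
    ℕ→ℚ-*⁴ a b c d rewrite ℕ→ℚ-* (a ℕ.* b ℕ.* c) d | ℕ→ℚ-* (a ℕ.* b) c | ℕ→ℚ-* a b = refl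

module FiniteSums {c ℓ} (R : CommutativeRing c ℓ) where

  open import Data.Nat as ℕ using (ℕ; zero; suc; _∸_; _≤_; z≤n)
  import Data.Nat.Properties as ℕ
  import Relation.Binary.PropositionalEquality as ≡
  open Naturals using (double)

  open CommutativeRing R
  open import Relation.Binary.Reasoning.Setoid setoid
  open import Algebra.Properties.Ring ring using (-‿+-comm)
  open import Algebra.Properties.CommutativeSemigroup +-commutativeSemigroup
    using () renaming (interchange to +-interchange)

  ∑ : ℕ → (ℕ → Carrier) → Carrier
  ∑ zero    f = f 0
  ∑ (suc m) f = ∑ m f + f (suc m)

  ∑-cong-≤ : ∀ m {f g} → (∀ a → a ≤ m → f a ≈ g a) → ∑ m f ≈ ∑ m g
  ∑-cong-≤ zero    f≈g = f≈g 0 z≤n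
  ∑-cong-≤ (suc m) f≈g = +-cong (∑-cong-≤ m (λ a a≤m → f≈g a (ℕ.m≤n⇒m≤1+n a≤m))) (f≈g (suc m) ℕ.≤-refl)

  ∑-cong : ∀ m {f g} → (∀ a → f a ≈ g a) → ∑ m f ≈ ∑ m g
  ∑-cong m f≈g = ∑-cong-≤ m (λ a _ → f≈g a)

  ∑-distrib-+ : ∀ m f g → ∑ m (λ a → f a + g a) ≈ ∑ m f + ∑ m g
  ∑-distrib-+ zero    f g = refl
  ∑-distrib-+ (suc m) f g = trans (+-congʳ (∑-distrib-+ m f g)) (+-interchange _ _ _ _)

  *-distribˡ-∑ : ∀ m x f → x * ∑ m f ≈ ∑ m (λ a → x * f a)
  *-distribˡ-∑ zero    x f = refl
  *-distribˡ-∑ (suc m) x f = trans (distribˡ x (∑ m f) (f (suc m))) (+-congʳ (*-distribˡ-∑ m x f))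

  *-distribʳ-∑ : ∀ m x f → ∑ m f * x ≈ ∑ m (λ a → f a * x)
  *-distribʳ-∑ m x f = trans (*-comm _ x) (trans (*-distribˡ-∑ m x f) (∑-cong m (λ a → *-comm x (f a))))

  -‿distrib-∑ : ∀ m f → ∑ m (λ a → - f a) ≈ - ∑ m f
  -‿distrib-∑ zero    f = refl
  -‿distrib-∑ (suc m) f = trans (+-congʳ (-‿distrib-∑ m f)) (-‿+-comm _ _)

  ∑[f-g]≈∑f-∑g : ∀ m f g → ∑ m (λ a → f a - g a) ≈ ∑ m f - ∑ m g
  ∑[f-g]≈∑f-∑g m f g = trans (∑-distrib-+ m f (λ a → - g a)) (+-congˡ (-‿distrib-∑ m g))

  ∑-zero : ∀ m → ∑ m (λ _ → 0#) ≈ 0#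
  ∑-zero zero    = refl
  ∑-zero (suc m) = trans (+-identityʳ _) (∑-zero m)

  ∑-head : ∀ m f → ∑ (suc m) f ≈ f 0 + ∑ m (λ a → f (suc a))
  ∑-head zero    f = refl
  ∑-head (suc m) f = trans (+-congʳ (∑-head m f)) (+-assoc _ _ _)

  ∑-dropLast : ∀ m {f} → f (suc m) ≈ 0# → ∑ (suc m) f ≈ ∑ m f
  ∑-dropLast m f[1+m]≈0 = trans (+-congˡ f[1+m]≈0) (+-identityʳ _)

  ∑-truncate : ∀ m k {f} → (∀ i → f (suc (m ℕ.+ i)) ≈ 0#) → ∑ (m ℕ.+ k) f ≈ ∑ m f
  ∑-truncate m zero    {f} tail≈0 = reflexive (≡.cong (λ n → ∑ n f) (ℕ.+-identityʳ m))
  ∑-truncate m (suc k) {f} tail≈0 = begin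
    ∑ (m ℕ.+ suc k) f   ≡⟨ ≡.cong (λ n → ∑ n f) (ℕ.+-suc m k) ⟩
    ∑ (suc (m ℕ.+ k)) f ≈⟨ ∑-dropLast (m ℕ.+ k) (tail≈0 k) ⟩
    ∑ (m ℕ.+ k) f       ≈⟨ ∑-truncate m k tail≈0 ⟩
    ∑ m f               ∎

  ∑-reverse : ∀ m f → ∑ m (λ a → f (m ∸ a)) ≈ ∑ m f
  ∑-reverse zero    f = refl
  ∑-reverse (suc m) f = begin
    ∑ (suc m) (λ a → f (suc m ∸ a)) ≈⟨ ∑-head m _ ⟩
    f (suc m) + ∑ m (λ a → f (m ∸ a)) ≈⟨ +-congˡ (∑-reverse m f) ⟩
    f (suc m) + ∑ m f                 ≈⟨ +-comm _ _ ⟩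
    ∑ m f + f (suc m)                 ∎

  ∑-evens : ∀ m F → (∀ j → F (suc (double j)) ≈ 0#) → ∑ (double m) F ≈ ∑ m (λ j → F (double j))
  ∑-evens zero    F odd≈0 = refl
  ∑-evens (suc m) F odd≈0 = +-congʳ (trans (∑-dropLast (double m) (odd≈0 m)) (∑-evens m F odd≈0))

  ∑-triangle : ∀ i (F : ℕ → ℕ → Carrier) →
    ∑ i (λ a → ∑ a (F a)) ≈ ∑ i (λ b → ∑ (i ∸ b) (λ c → F (b ℕ.+ c) b))
  ∑-triangle zero    F = refl
  ∑-triangle (suc i) F = begin
    ∑ i (λ a → ∑ a (F a)) + (∑ i (F (suc i)) + F (suc i) (suc i))
      ≈⟨ +-congʳ (∑-triangle i F) ⟩
    ∑ i (λ b → ∑ (i ∸ b) (column b)) + (∑ i (F (suc i)) + F (suc i) (suc i))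
      ≈⟨ +-assoc _ _ _ ⟨
    ∑ i (λ b → ∑ (i ∸ b) (column b)) + ∑ i (F (suc i)) + F (suc i) (suc i)
      ≈⟨ +-cong (∑-distrib-+ i _ _) corner ⟨
    ∑ i (λ b → ∑ (i ∸ b) (column b) + F (suc i) b) + ∑ (i ∸ i) (column (suc i))
      ≈⟨ +-congʳ (∑-cong-≤ i extend) ⟩
    ∑ (suc i) (λ b → ∑ (suc i ∸ b) (column b)) ∎
    where
    column : ℕ → ℕ → Carrier
    column b c = F (b ℕ.+ c) b
    corner : ∑ (i ∸ i) (column (suc i)) ≈ F (suc i) (suc i)
    corner rewrite ℕ.n∸n≡0 i | ℕ.+-identityʳ i = refl
    extend : ∀ b → b ≤ i → ∑ (i ∸ b) (column b) + F (suc i) b ≈ ∑ (suc i ∸ b) (column b)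
    extend b b≤i rewrite ℕ.+-∸-assoc 1 b≤i =
      +-congˡ (reflexive (≡.cong (λ n → F n b) (≡.sym (≡.trans (ℕ.+-suc b (i ∸ b)) (≡.cong suc (ℕ.m+[n∸m]≡n b≤i))))))

module PowerSeries {c ℓ} (R : CommutativeRing c ℓ) where

  open import Data.Nat as ℕ using (ℕ; zero; suc; _∸_)
  import Data.Nat.Properties as ℕ
  open import Data.Product using (_,_)
  import Relation.Binary.PropositionalEquality as ≡
  open import Algebra.Structures using (IsCommutativeRing)

  open CommutativeRing R
  open import Relation.Binary.Reasoning.Setoid setoid
  open import Algebra.Properties.Ring ring using (-0#≈0#)
  open FiniteSums R

  Series : Set c
  Series = ℕ → Carrier

  infix  4 _≋_
  infixl 6 _⊕_
  infixl 7 _⊛_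

  _≋_ : Series → Series → Set ℓ
  f ≋ g = ∀ i → f i ≈ g i

  _⊕_ : Series → Series → Series
  (f ⊕ g) i = f i + g i

  _⊛_ : Series → Series → Series
  (f ⊛ g) i = ∑ i (λ a → f a * g (i ∸ a))

  ⊖_ : Series → Series
  (⊖ f) i = - f i

  const : Carrier → Series
  const x zero    = x
  const x (suc _) = 0#

  𝟘 : Series
  𝟘 _ = 0#

  𝟙 : Series
  𝟙 = const 1#

  const-⊛ : ∀ x f → const x ⊛ f ≋ λ i → x * f i
  const-⊛ x f zero    = refl
  const-⊛ x f (suc i) = begin
    ∑ (suc i) (λ a → const x a * f (suc i ∸ a))    ≈⟨ ∑-head i _ ⟩
    x * f (suc i) + ∑ i (λ a → 0# * f (i ∸ a))     ≈⟨ +-congˡ (trans (∑-cong i (λ a → zeroˡ _)) (∑-zero i)) ⟩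
    x * f (suc i) + 0#                             ≈⟨ +-identityʳ _ ⟩
    x * f (suc i)                                  ∎

  ⊛-cong : ∀ {f f′ g g′} → f ≋ f′ → g ≋ g′ → f ⊛ g ≋ f′ ⊛ g′
  ⊛-cong f≋f′ g≋g′ i = ∑-cong i (λ a → *-cong (f≋f′ a) (g≋g′ (i ∸ a)))

  ⊛-comm : ∀ f g → f ⊛ g ≋ g ⊛ f
  ⊛-comm f g i = begin
    ∑ i (λ a → f a * g (i ∸ a))                 ≈⟨ ∑-reverse i _ ⟨
    ∑ i (λ a → f (i ∸ a) * g (i ∸ (i ∸ a)))     ≈⟨ ∑-cong-≤ i (λ a a≤i → trans (*-comm _ _) (*-congʳ (reflexive (≡.cong g (ℕ.m∸[m∸n]≡n a≤i))))) ⟩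
    ∑ i (λ a → g a * f (i ∸ a))                 ∎

  ⊛-assoc : ∀ f g h → (f ⊛ g) ⊛ h ≋ f ⊛ (g ⊛ h)
  ⊛-assoc f g h i = begin
    ∑ i (λ a → ∑ a (λ b → f b * g (a ∸ b)) * h (i ∸ a))
      ≈⟨ ∑-cong i (λ a → *-distribʳ-∑ a _ _) ⟩
    ∑ i (λ a → ∑ a (λ b → f b * g (a ∸ b) * h (i ∸ a)))
      ≈⟨ ∑-triangle i _ ⟩
    ∑ i (λ b → ∑ (i ∸ b) (λ c → f b * g (b ℕ.+ c ∸ b) * h (i ∸ (b ℕ.+ c))))
      ≈⟨ ∑-cong i (λ b → ∑-cong (i ∸ b) (λ c → trans (*-assoc _ _ _) (*-congˡ (*-cong
           (reflexive (≡.cong g (ℕ.m+n∸m≡n b c))) (reflexive (≡.cong h (≡.sym (ℕ.∸-+-assoc i b c)))))))) ⟩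
    ∑ i (λ b → ∑ (i ∸ b) (λ c → f b * (g c * h (i ∸ b ∸ c))))
      ≈⟨ ∑-cong i (λ b → *-distribˡ-∑ (i ∸ b) _ _) ⟨
    ∑ i (λ b → f b * ∑ (i ∸ b) (λ c → g c * h (i ∸ b ∸ c))) ∎

  ⊛-identityˡ : ∀ f → 𝟙 ⊛ f ≋ f
  ⊛-identityˡ f i = trans (const-⊛ 1# f i) (*-identityˡ (f i))

  ⊛-identityʳ : ∀ f → f ⊛ 𝟙 ≋ f
  ⊛-identityʳ f i = trans (⊛-comm f 𝟙 i) (⊛-identityˡ f i)

  ⊛-distribˡ-⊕ : ∀ f g h → f ⊛ (g ⊕ h) ≋ f ⊛ g ⊕ f ⊛ h
  ⊛-distribˡ-⊕ f g h i = trans (∑-cong i (λ a → distribˡ _ _ _)) (∑-distrib-+ i _ _)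

  ⊛-distribʳ-⊕ : ∀ f g h → (g ⊕ h) ⊛ f ≋ g ⊛ f ⊕ h ⊛ f
  ⊛-distribʳ-⊕ f g h i = trans (⊛-comm (g ⊕ h) f i)
    (trans (⊛-distribˡ-⊕ f g h i) (+-cong (⊛-comm f g i) (⊛-comm f h i)))

  ⊕-⊛-isCommutativeRing : IsCommutativeRing _≋_ _⊕_ _⊛_ ⊖_ 𝟘 𝟙
  ⊕-⊛-isCommutativeRing = record
    { isRing = record
      { +-isAbelianGroup = record
        { isGroup = record
          { isMonoid = record
            { isSemigroup = record
              { isMagma = record
                { isEquivalence = record
                  { refl  = λ i → refl
                  ; sym   = λ f≋g i → sym (f≋g i)
                  ; trans = λ f≋g g≋h i → trans (f≋g i) (g≋h i)
                  }
                ; ∙-cong = λ f≋f′ g≋g′ i → +-cong (f≋f′ i) (g≋g′ i)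
                }
              ; assoc = λ f g h i → +-assoc (f i) (g i) (h i)
              }
            ; identity = (λ f i → +-identityˡ (f i)) , (λ f i → +-identityʳ (f i))
            }
          ; inverse = (λ f i → -‿inverseˡ (f i)) , (λ f i → -‿inverseʳ (f i))
          ; ⁻¹-cong = λ f≋g i → -‿cong (f≋g i)
          }
        ; comm = λ f g i → +-comm (f i) (g i)
        }
      ; *-cong     = ⊛-cong
      ; *-assoc    = ⊛-assoc
      ; *-identity = ⊛-identityˡ , ⊛-identityʳ
      ; distrib    = ⊛-distribˡ-⊕ , ⊛-distribʳ-⊕
      }
    ; *-comm = ⊛-comm
    }

  seriesRing : CommutativeRing c ℓ
  seriesRing = record { isCommutativeRing = ⊕-⊛-isCommutativeRing }

  const-+ : ∀ x y → const (x + y) ≋ const x ⊕ const y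
  const-+ x y zero    = refl
  const-+ x y (suc i) = sym (+-identityʳ 0#)

  const-* : ∀ x y → const (x * y) ≋ const x ⊛ const y
  const-* x y i = trans (scaled i) (sym (const-⊛ x (const y) i))
    where
    scaled : ∀ i → const (x * y) i ≈ x * const y i
    scaled zero    = refl
    scaled (suc i) = sym (zeroʳ x)

  const-neg : ∀ x → const (- x) ≋ ⊖ const x
  const-neg x zero    = refl
  const-neg x (suc i) = sym -0#≈0#

  const-cong : ∀ {x y} → x ≈ y → const x ≋ const y
  const-cong x≈y zero    = x≈y
  const-cong x≈y (suc i) = refl

module Waring {c ℓ} (R : CommutativeRing c ℓ) where

  open import Data.Nat as ℕ using (ℕ; zero; suc; _∸_; _<_; _≤?_; s≤s)
  import Data.Nat.Properties as ℕ
  open import Relation.Nullary using (yes; no)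
  open Naturals using (double; lucasCoeff; lucasCoeff-head; lucasCoeff-vanishes; n<double[1+n])

  open CommutativeRing R
  open import Relation.Binary.Reasoning.Setoid setoid
  open import Algebra.Properties.CommutativeSemiring.Exp commutativeSemiring using (_^_)
  open import Algebra.Properties.Semiring.Mult semiring using (_×_; ×-homo-+; ×-homo-1)
  open import Algebra.Properties.Ring ring using (-1*x≈-x; [y-z]x≈yx-zx)
  open import Algebra.Solver.Ring.NaturalCoefficients.Default commutativeSemiring
  open FiniteSums R

  x≈z+y⇒x-y≈z : ∀ {x y z} → x ≈ z + y → x - y ≈ z
  x≈z+y⇒x-y≈z {x} {y} {z} x≈z+y = begin
    x + - y       ≈⟨ +-congʳ x≈z+y ⟩
    z + y + - y   ≈⟨ +-assoc z y (- y) ⟩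
    z + (y + - y) ≈⟨ +-congˡ (-‿inverseʳ y) ⟩
    z + 0#        ≈⟨ +-identityʳ z ⟩
    z             ∎

  signedLucas : ℕ → ℕ → Carrier
  signedLucas n j = (- 1#) ^ j * (lucasCoeff n j × 1#)

  signedLucas-head : ∀ n → signedLucas (suc n) 0 ≈ 1#
  signedLucas-head n rewrite lucasCoeff-head n = trans (*-identityˡ _) (×-homo-1 1#)

  signedLucas-vanishes : ∀ {n j} → n < double j → signedLucas n j ≈ 0#
  signedLucas-vanishes {n} {j} n<2j rewrite lucasCoeff-vanishes n<2j = zeroʳ _

  signedLucas-recurrence : ∀ n j →
    signedLucas (suc (suc n)) (suc j) ≈ signedLucas (suc n) (suc j) - signedLucas n j
  signedLucas-recurrence n j = begin
    σ′ * ((L₁ ℕ.+ L₂) × 1#)          ≈⟨ *-congˡ (×-homo-+ 1# L₁ L₂) ⟩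
    σ′ * (L₁ × 1# + L₂ × 1#)         ≈⟨ distribˡ σ′ (L₁ × 1#) (L₂ × 1#) ⟩
    σ′ * (L₁ × 1#) + σ′ * (L₂ × 1#)  ≈⟨ +-congˡ (trans (*-assoc (- 1#) σ (L₂ × 1#)) (-1*x≈-x _)) ⟩
    signedLucas (suc n) (suc j) - signedLucas n j ∎
    where
    σ  = (- 1#) ^ j
    σ′ = (- 1#) ^ suc j
    L₁ = lucasCoeff (suc n) (suc j)
    L₂ = lucasCoeff n j

  module _ (u v : Carrier) where

    s p : Carrier
    s = u + v
    p = u * v

    waringTerm : ℕ → ℕ → Carrier
    waringTerm n j = signedLucas n j * (s ^ (n ∸ double j) * p ^ j)

    waringTerm-vanishes : ∀ {n j} → n < double j → waringTerm n j ≈ 0#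
    waringTerm-vanishes n<2j = trans (*-congʳ (signedLucas-vanishes n<2j)) (zeroˡ _)

    powerSum-recurrence : ∀ n →
      u ^ suc (suc n) + v ^ suc (suc n) ≈ s * (u ^ suc n + v ^ suc n) - p * (u ^ n + v ^ n)
    powerSum-recurrence n = sym (x≈z+y⇒x-y≈z (solve 4
      (λ u v U V → (u :+ v) :* (u :* U :+ v :* V) := u :* (u :* U) :+ v :* (v :* V) :+ (u :* v) :* (U :+ V))
      refl u v (u ^ n) (v ^ n)))

    waringTerm-head : ∀ n → waringTerm (suc (suc n)) 0 ≈ s * waringTerm (suc n) 0
    waringTerm-head n = begin
      signedLucas (suc (suc n)) 0 * (s * s ^ suc n * 1#)  ≈⟨ *-congʳ (trans (signedLucas-head (suc n)) (sym (signedLucas-head n))) ⟩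
      signedLucas (suc n) 0 * (s * s ^ suc n * 1#)        ≈⟨ solve 3 (λ c s S → c :* (s :* S :* con 1) := s :* (c :* (S :* con 1))) refl _ s _ ⟩
      s * (signedLucas (suc n) 0 * (s ^ suc n * 1#))      ∎

    waringTerm-shift : ∀ n j →
      signedLucas (suc n) (suc j) * (s ^ (n ∸ double j) * p ^ suc j) ≈ s * waringTerm (suc n) (suc j)
    -- Either L(n+1, j+1) = 0, or 2j + 2 ≤ n + 1 and s^(n − 2j) = s · s^((n+1) − (2j+2)).
    waringTerm-shift n j with double (suc j) ≤? suc n
    ... | yes (s≤s 1+2j≤n) rewrite ℕ.+-∸-assoc 1 1+2j≤n =
      solve 4 (λ c s S P → c :* (s :* S :* P) := s :* (c :* (S :* P))) refl _ s _ _
    ... | no 2j+2≰n+1 = begin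
      signedLucas (suc n) (suc j) * (s ^ (n ∸ double j) * p ^ suc j) ≈⟨ *-congʳ (signedLucas-vanishes n+1<2j+2) ⟩
      0# * (s ^ (n ∸ double j) * p ^ suc j)                          ≈⟨ zeroˡ _ ⟩
      0#                                                             ≈⟨ zeroʳ s ⟨
      s * 0#                                                         ≈⟨ *-congˡ (waringTerm-vanishes n+1<2j+2) ⟨
      s * waringTerm (suc n) (suc j)                                 ∎
      where n+1<2j+2 = ℕ.≰⇒> 2j+2≰n+1

    waringTerm-recurrence : ∀ n j →
      waringTerm (suc (suc n)) (suc j) ≈ s * waringTerm (suc n) (suc j) - p * waringTerm n j
    waringTerm-recurrence n j = begin
      signedLucas (suc (suc n)) (suc j) * M                    ≈⟨ *-congʳ (signedLucas-recurrence n j) ⟩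
      (signedLucas (suc n) (suc j) - signedLucas n j) * M      ≈⟨ [y-z]x≈yx-zx M _ _ ⟩
      signedLucas (suc n) (suc j) * M - signedLucas n j * M    ≈⟨ +-cong (waringTerm-shift n j) (-‿cong factor-p) ⟩
      s * waringTerm (suc n) (suc j) - p * waringTerm n j      ∎
      where
      M = s ^ (n ∸ double j) * p ^ suc j
      factor-p : signedLucas n j * M ≈ p * waringTerm n j
      factor-p = solve 4 (λ c S p P → c :* (S :* (p :* P)) := p :* (c :* (S :* P))) refl _ _ p _

    waringSum : ℕ → Carrier
    waringSum n = ∑ n (waringTerm n)

    waringSum-recurrence : ∀ n → waringSum (suc (suc n)) ≈ s * waringSum (suc n) - p * waringSum n
    waringSum-recurrence n = begin
      waringSum (suc (suc n))
        ≈⟨ ∑-head (suc n) _ ⟩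
      waringTerm (suc (suc n)) 0 + ∑ (suc n) (λ j → waringTerm (suc (suc n)) (suc j))
        ≈⟨ +-cong (waringTerm-head n) (trans (∑-cong (suc n) (waringTerm-recurrence n)) (∑[f-g]≈∑f-∑g (suc n) _ _)) ⟩
      s * t₁ 0 + (∑ (suc n) (λ j → s * t₁ (suc j)) - ∑ (suc n) (λ j → p * t₀ j))
        ≈⟨ +-congˡ (+-cong (∑-dropLast n last₁) (-‿cong (trans (∑-dropLast n last₀) (sym (*-distribˡ-∑ n p t₀))))) ⟩
      s * t₁ 0 + (∑ n (λ j → s * t₁ (suc j)) - p * waringSum n)
        ≈⟨ +-assoc _ _ _ ⟨
      s * t₁ 0 + ∑ n (λ j → s * t₁ (suc j)) - p * waringSum n
        ≈⟨ +-congʳ (trans (+-congˡ (sym (*-distribˡ-∑ n s _))) (sym (distribˡ s _ _))) ⟩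
      s * (t₁ 0 + ∑ n (λ j → t₁ (suc j))) - p * waringSum n
        ≈⟨ +-congʳ (*-congˡ (∑-head n t₁)) ⟨
      s * waringSum (suc n) - p * waringSum n ∎
      where
      t₁ = waringTerm (suc n)
      t₀ = waringTerm n
      last₁ : s * t₁ (suc (suc n)) ≈ 0#
      last₁ = trans (*-congˡ (waringTerm-vanishes (n<double[1+n] (suc n)))) (zeroʳ s)
      last₀ : p * t₀ (suc n) ≈ 0#
      last₀ = trans (*-congˡ (waringTerm-vanishes (n<double[1+n] n))) (zeroʳ p)

    waring : ∀ n → u ^ n + v ^ n ≈ waringSum n
    waring zero          = solve 0 (con 1 :+ con 1 := (con 1 :* (con 1 :+ (con 1 :+ con 0))) :* (con 1 :* con 1)) refl
    -- The semiring solver has no negation; (−1)^1 enters as the atom m, multiplied by L(1, 1) = 0.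
    waring (suc zero)    = solve 3
      (λ u v m → u :* con 1 :+ v :* con 1
              := (con 1 :* (con 1 :+ con 0)) :* ((u :+ v) :* con 1 :* con 1) :+ m :* con 1 :* con 0 :* (con 1 :* (u :* v :* con 1)))
      refl u v (- 1#)
    waring (suc (suc n)) = begin
      u ^ suc (suc n) + v ^ suc (suc n)                       ≈⟨ powerSum-recurrence n ⟩
      s * (u ^ suc n + v ^ suc n) - p * (u ^ n + v ^ n)       ≈⟨ +-cong (*-congˡ (waring (suc n))) (-‿cong (*-congˡ (waring n))) ⟩
      s * waringSum (suc n) - p * waringSum n                 ≈⟨ waringSum-recurrence n ⟨
      waringSum (suc (suc n))                                 ∎

open Naturals
open Rationals using (ℕ→ℚ-+; termCoeff; termCoeff-double)
open import Data.Nat as ℕ using (zero; suc; _∸_; _%_; _/_)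
import Data.Nat.Properties as ℕ
open import Data.Rational as ℚ using (ℚ; 0ℚ; 1ℚ)
import Data.Rational.Properties as ℚ
open import Relation.Binary.PropositionalEquality as ≡ using (_≡_)
open import Relation.Nullary using (yes; no; ¬_)
open import Data.Empty using (⊥-elim)
open import Level using (0ℓ)

module ℚ[[Y]] = PowerSeries ℚ.+-*-commutativeRing
module ℚ[[Y]][[X]] = PowerSeries ℚ[[Y]].seriesRing

-- Poly = ℕ → ℕ → ℚ is definitionally the carrier of ℚ[[Y]][[X]], with _+P_ as its addition
-- and _≈P_ as its equality; _*P_, _^P_, _·P_ and sumP agree with the ring operations below.
Polys : CommutativeRing 0ℓ 0ℓ
Polys = ℚ[[Y]][[X]].seriesRing

open CommutativeRing Polys hiding (zero)
open import Relation.Binary.Reasoning.Setoid setoid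
open FiniteSums Polys
open import Algebra.Properties.CommutativeSemiring.Exp commutativeSemiring using (_^_; ^-assocʳ; ^-distrib-*; ^-congˡ)
open import Algebra.Properties.Semiring.Mult semiring using (_×_)

sumTo≡∑ : ∀ m f → sumTo m f ≡ FiniteSums.∑ ℚ.+-*-commutativeRing m f
sumTo≡∑ zero    f = ≡.refl
sumTo≡∑ (suc m) f = ≡.cong (ℚ._+ f (suc m)) (sumTo≡∑ m f)

∑-coefficient : ∀ m F j → FiniteSums.∑ ℚ[[Y]].seriesRing m F j ≡ sumTo m (λ a → F a j)
∑-coefficient zero    F j = ≡.refl
∑-coefficient (suc m) F j = ≡.cong (ℚ._+ F (suc m) j) (∑-coefficient m F j)

sumTo-cong : ∀ m {f g} → (∀ a → f a ≡ g a) → sumTo m f ≡ sumTo m g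
sumTo-cong zero    f≡g = f≡g 0
sumTo-cong (suc m) f≡g = ≡.cong₂ ℚ._+_ (sumTo-cong m f≡g) (f≡g (suc m))

*P≈* : ∀ p q → p *P q ≈ p * q
*P≈* p q i j = ≡.sym (≡.trans (∑-coefficient i _ j) (sumTo-cong i (λ a → ≡.sym (sumTo≡∑ j _))))

sumP≈∑ : ∀ m F → sumP m F ≈ ∑ m F
sumP≈∑ zero    F = refl
sumP≈∑ (suc m) F = +-congʳ (sumP≈∑ m F)

scalar : ℚ → Poly
scalar c = ℚ[[Y]][[X]].const (ℚ[[Y]].const c)

constP≈scalar : ∀ c → constP c ≈ scalar c
constP≈scalar c zero    zero    = ℚ.*-identityʳ c
constP≈scalar c zero    (suc j) = ℚ.*-zeroʳ c
constP≈scalar c (suc i) j       = ≡.trans (≡.cong (c ℚ.*_) (ℚ.*-zeroˡ (δ j 0))) (ℚ.*-zeroʳ c)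

·P≈scalar* : ∀ c p → c ·P p ≈ scalar c * p
·P≈scalar* c p i j = ≡.sym (≡.trans (ℚ[[Y]][[X]].const-⊛ (ℚ[[Y]].const c) p i j) (ℚ[[Y]].const-⊛ c (p i) j))

^P≈^ : ∀ p m → p ^P m ≈ p ^ m
^P≈^ p zero    = constP≈scalar 1ℚ
^P≈^ p (suc m) = begin
  (p ^P m) *P p ≈⟨ *P≈* (p ^P m) p ⟩
  (p ^P m) * p  ≈⟨ *-congʳ {p} (^P≈^ p m) ⟩
  p ^ m * p     ≈⟨ *-comm (p ^ m) p ⟩
  p ^ suc m     ∎

scalar-0 : scalar 0ℚ ≈ 0#
scalar-0 zero    zero    = ≡.refl
scalar-0 zero    (suc j) = ≡.refl
scalar-0 (suc i) j       = ≡.refl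

scalar-+ : ∀ a b → scalar (a ℚ.+ b) ≈ scalar a + scalar b
scalar-+ a b = trans (ℚ[[Y]][[X]].const-cong (ℚ[[Y]].const-+ a b)) (ℚ[[Y]][[X]].const-+ _ _)

scalar-* : ∀ a b → scalar (a ℚ.* b) ≈ scalar a * scalar b
scalar-* a b = trans (ℚ[[Y]][[X]].const-cong (ℚ[[Y]].const-* a b)) (ℚ[[Y]][[X]].const-* _ _)

scalar-neg : ∀ a → scalar (ℚ.- a) ≈ - scalar a
scalar-neg a = trans (ℚ[[Y]][[X]].const-cong (ℚ[[Y]].const-neg a)) (ℚ[[Y]][[X]].const-neg _)

scalar-ℕ→ℚ : ∀ m → scalar (ℕ→ℚ m) ≈ m × 1#
scalar-ℕ→ℚ zero    = scalar-0
scalar-ℕ→ℚ (suc m) = begin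
  scalar (ℕ→ℚ (suc m))    ≡⟨ ≡.cong scalar (ℕ→ℚ-+ 1 m) ⟩
  scalar (1ℚ ℚ.+ ℕ→ℚ m)   ≈⟨ scalar-+ 1ℚ (ℕ→ℚ m) ⟩
  1# + scalar (ℕ→ℚ m)     ≈⟨ +-congˡ {1#} (scalar-ℕ→ℚ m) ⟩
  1# + m × 1#             ∎

scalar-sign : ∀ j → scalar ((ℚ.- 1ℚ) ^ℚ j) ≈ (- 1#) ^ j
scalar-sign zero    = refl
scalar-sign (suc j) = begin
  scalar ((ℚ.- 1ℚ) ^ℚ j ℚ.* ℚ.- 1ℚ)       ≈⟨ scalar-* ((ℚ.- 1ℚ) ^ℚ j) (ℚ.- 1ℚ) ⟩
  scalar ((ℚ.- 1ℚ) ^ℚ j) * scalar (ℚ.- 1ℚ) ≈⟨ *-cong (scalar-sign j) (scalar-neg 1ℚ) ⟩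
  (- 1#) ^ j * - 1#                      ≈⟨ *-comm ((- 1#) ^ j) (- 1#) ⟩
  (- 1#) ^ suc j                         ∎

module W = Waring Polys

u v : Poly
u = X ^ 2
v = Y ^ 2

^-double : ∀ x j → x ^ double j ≈ (x ^ 2) ^ j
^-double x j = begin
  x ^ double j   ≡⟨ ≡.cong (x ^_) (≡.trans (double≡* j) (ℕ.*-comm j 2)) ⟩
  x ^ (2 ℕ.* j)  ≈⟨ ^-assocʳ x 2 j ⟨
  (x ^ 2) ^ j    ∎

termPoly : ℕ → ℕ → Poly
termPoly n k = (((X ^P 2) +P (Y ^P 2)) ^P (n ∸ k)) *P ((X *P Y) ^P k)

term-even : ∀ n k → k % 2 ≡ 0 → term n k ≡ termCoeff n k ·P termPoly n k
term-even n k k-even with k % 2 ℕ.≟ 0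
... | yes _     = ≡.refl
... | no  k-odd = ⊥-elim (k-odd k-even)

term-odd : ∀ n k → ¬ k % 2 ≡ 0 → term n k ≡ 0P
term-odd n k k-odd with k % 2 ℕ.≟ 0
... | yes k-even = ⊥-elim (k-odd k-even)
... | no  _      = ≡.refl

termPoly-double : ∀ n j → termPoly n (double j) ≈ W.s u v ^ (n ∸ double j) * W.p u v ^ j
termPoly-double n j = begin
  (S ^P (n ∸ double j)) *P ((X *P Y) ^P double j)
    ≈⟨ *P≈* (S ^P (n ∸ double j)) ((X *P Y) ^P double j) ⟩
  (S ^P (n ∸ double j)) * ((X *P Y) ^P double j)
    ≈⟨ *-cong (trans (^P≈^ S (n ∸ double j)) (^-congˡ (n ∸ double j) S≈s))
              (trans (^P≈^ (X *P Y) (double j)) (^-congˡ (double j) (*P≈* X Y))) ⟩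
  W.s u v ^ (n ∸ double j) * (X * Y) ^ double j
    ≈⟨ *-congˡ {W.s u v ^ (n ∸ double j)} (trans (^-double (X * Y) j) (^-congˡ j (^-distrib-* X Y 2))) ⟩
  W.s u v ^ (n ∸ double j) * W.p u v ^ j ∎
  where
  S = (X ^P 2) +P (Y ^P 2)
  S≈s : S ≈ W.s u v
  S≈s = +-cong (^P≈^ X 2) (^P≈^ Y 2)

term-double : ∀ n j → double j ≤ n → 1 ≤ n → term n (double j) ≈ scalar (ΓNat n) * W.waringTerm u v n j
term-double n j 2j≤n 1≤n = begin
  term n (double j)
    ≡⟨ term-even n (double j) (double%2≡0 j) ⟩
  termCoeff n (double j) ·P termPoly n (double j)
    ≈⟨ ·P≈scalar* (termCoeff n (double j)) (termPoly n (double j)) ⟩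
  scalar (termCoeff n (double j)) * termPoly n (double j)
    ≈⟨ *-cong (reflexive (≡.cong scalar coefficient)) (termPoly-double n j) ⟩
  scalar (Γ ℚ.* (σ ℚ.* ℕ→ℚ L)) * M
    ≈⟨ *-congʳ {M} (trans (scalar-* Γ _) (*-congˡ {scalar Γ} (scalar-* σ (ℕ→ℚ L)))) ⟩
  scalar Γ * (scalar σ * scalar (ℕ→ℚ L)) * M
    ≈⟨ *-congʳ {M} (*-congˡ {scalar Γ} (*-cong (scalar-sign j) (scalar-ℕ→ℚ L))) ⟩
  scalar Γ * W.signedLucas n j * M
    ≈⟨ *-assoc (scalar Γ) (W.signedLucas n j) M ⟩
  scalar Γ * W.waringTerm u v n j ∎
  where
  Γ = ΓNat n
  σ = (ℚ.- 1ℚ) ^ℚ j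
  L = lucasCoeff n j
  M = W.s u v ^ (n ∸ double j) * W.p u v ^ j
  n≡2j+r = ≡.sym (ℕ.m+[n∸m]≡n 2j≤n)
  coefficient : termCoeff n (double j) ≡ Γ ℚ.* (σ ℚ.* ℕ→ℚ L)
  coefficient = ≡.subst (λ n → termCoeff n (double j) ≡ ΓNat n ℚ.* (σ ℚ.* ℕ→ℚ (lucasCoeff n j))) (≡.sym n≡2j+r)
    (termCoeff-double j (n ∸ double j) (≡.subst (1 ≤_) n≡2j+r 1≤n))

LHS≈RHS-double : ∀ m → LHS (double (suc m)) ≈ RHS (double (suc m))
LHS≈RHS-double m = begin
  sumP n (term n)                               ≈⟨ sumP≈∑ n (term n) ⟩
  ∑ n (term n)                                  ≈⟨ ∑-evens (suc m) (term n) odd-terms ⟩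
  ∑ (suc m) (λ j → term n (double j))           ≈⟨ ∑-cong-≤ (suc m) even-terms ⟩
  ∑ (suc m) (λ j → Γ * W.waringTerm u v n j)    ≈⟨ *-distribˡ-∑ (suc m) Γ (W.waringTerm u v n) ⟨
  Γ * ∑ (suc m) (W.waringTerm u v n)            ≈⟨ *-congˡ {Γ} (∑-truncate (suc m) (suc m) vanishing) ⟨
  Γ * ∑ (suc m ℕ.+ suc m) (W.waringTerm u v n)  ≡⟨ ≡.cong (λ k → Γ * ∑ k (W.waringTerm u v n)) (double≡+ (suc m)) ⟨
  Γ * W.waringSum u v n                         ≈⟨ *-congˡ {Γ} (W.waring u v n) ⟨
  Γ * (u ^ n + v ^ n)                           ≈⟨ *-congˡ {Γ} (+-cong (^-assocʳ X 2 n) (^-assocʳ Y 2 n)) ⟩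
  Γ * (X ^ (2 ℕ.* n) + Y ^ (2 ℕ.* n))          ≈⟨ *-congˡ {Γ} (+-cong (^P≈^ X (2 ℕ.* n)) (^P≈^ Y (2 ℕ.* n))) ⟨
  Γ * ((X ^P (2 ℕ.* n)) +P (Y ^P (2 ℕ.* n)))    ≈⟨ ·P≈scalar* (ΓNat n) ((X ^P (2 ℕ.* n)) +P (Y ^P (2 ℕ.* n))) ⟨
  RHS n                                         ∎
  where
  n = double (suc m)
  Γ = scalar (ΓNat n)
  odd-terms : ∀ j → term n (suc (double j)) ≈ 0#
  odd-terms j rewrite term-odd n (suc (double j)) (λ even → ℕ.1+n≢0 (≡.trans (≡.sym ([1+double]%2≡1 j)) even)) =
    λ i k → ℚ.*-zeroˡ (δ i 0 ℚ.* δ k 0)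
  even-terms : ∀ j → j ℕ.≤ suc m → term n (double j) ≈ Γ * W.waringTerm u v n j
  even-terms j j≤1+m = term-double n j (double-mono-≤ j≤1+m) (ℕ.s≤s ℕ.z≤n)
  vanishing : ∀ i → W.waringTerm u v n (suc (suc m ℕ.+ i)) ≈ 0#
  vanishing i = W.waringTerm-vanishes u v (double-mono-< (ℕ.s≤s (ℕ.s≤s (ℕ.m≤m+n m i))))

lemma3p12 : (n : ℕ) → 1 ≤ n → Even n → LHS n ≈P RHS n
lemma3p12 n 1≤n n-even with n / 2 | even⇒double n n-even
... | suc m | ≡.refl = LHS≈RHS-double m
lemma3p12 .zero () n-even | zero | ≡.refl
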